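{- Let $n=16$, $k=3$, and let $w=(8,6,6,4,1,1,0,0,0,0,-2,-2,-3,-3,-5,-12)\in\mathbf{R}^{16}$. Let $K^0=\{S\subset[16] : |S|=3,\ \sum_{i\in S} w_i = 0\}$. Then the point $$p=(2,1,1,2,1,1,1,1,1,1,1,1,2,2,2,1)$$ lies in $D(K^0)\cap L$, but $p$ is not the degree sequence of any subhypergraph of $K^0$, i.e. there is no $K\subseteq K^0$ with $p=\sum_{S\in K} e_S$.
   Context: For $S\subset[n]$, $e_S=\sum_{i\in S}e_i$, where $e_i$ is the $i$th standard basis vector of $\mathbf{R}^n$. For a set $K$ of $k$-element subsets of $[n]$ (a $k$-uniform hypergraph), $D(K)=\{\sum_{S\in K} c_S e_S : 0\le c_S\le 1\}$ is the zonotope generated by its hyperedges. $L\subset\mathbf{Z}^n$ is the lattice generated by all $e_S$ with $|S|=k$; for $n>k$ it consists of the integer vectors whose coordinate sum is divisible by $k$. The degree sequence of a subhypergraph $K\subseteq K^0$ is $\sum_{S\in K}e_S$. -}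

module Defs where

open import Data.Nat as ℕ using (ℕ; zero; suc)
open import Data.Integer as ℤ using (ℤ; +_; -[1+_])
open import Data.Rational as ℚ using (ℚ)
open import Data.Bool using (Bool; true; false; if_then_else_)
open import Data.Fin using (Fin)
open import Data.Fin.Subset using (Subset; ∣_∣)
open import Data.Vec using (Vec; []; _∷_; lookup)
open import Data.List using (List; []; _∷_; _++_; map; filter; allFin; foldr)
open import Data.Nat.ListAction using (sum)
open import Data.List.Membership.Propositional using (_∈_)
open import Data.List.Relation.Unary.All using (All)
open import Data.List.Relation.Unary.Unique.Propositional using (Unique)
open import Data.Product using (Σ; ∃; _×_; _,_; proj₁; proj₂)
open import Relation.Binary.PropositionalEquality using (_≡_)
open import Relation.Nullary.Decidable using (_×-dec_)
import Data.Nat.Properties as ℕP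
import Data.Integer.Properties as ℤP

allSubsets : (n : ℕ) → List (Subset n)
allSubsets zero = [] ∷ []
allSubsets (suc n) = map (true ∷_) (allSubsets n) ++ map (false ∷_) (allSubsets n)

sumℤ : List ℤ → ℤ
sumℤ = foldr ℤ._+_ (+ 0)

sumℚ : List ℚ → ℚ
sumℚ = foldr ℚ._+_ ℚ.0ℚ

eℕ : {n : ℕ} → Subset n → Fin n → ℕ
eℕ S i = if lookup S i then 1 else 0

eℤ : {n : ℕ} → Subset n → Fin n → ℤ
eℤ S i = + (eℕ S i)

eℚ : {n : ℕ} → Subset n → Fin n → ℚ
eℚ S i = if lookup S i then ℚ.1ℚ else ℚ.0ℚ

weightSum : {n : ℕ} → (Fin n → ℤ) → Subset n → ℤ
weightSum {n} w S = sumℤ (map (λ i → if lookup S i then w i else + 0) (allFin n))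

K0 : (n k : ℕ) → (Fin n → ℤ) → List (Subset n)
K0 n k w = filter (λ S → (∣ S ∣ ℕP.≟ k) ×-dec (weightSum w S ℤP.≟ + 0)) (allSubsets n)

-- Zonotope D(K) = { ∑_{S∈K} c_S e_S : 0 ≤ c_S ≤ 1 }  (K a duplicate-free list;
-- coefficients are rational)
InZonotope : {n : ℕ} → List (Subset n) → (Fin n → ℚ) → Set
InZonotope {n} K x =
  Σ (Subset n → ℚ) λ c →
    (∀ S → S ∈ K → (ℚ.0ℚ ℚ.≤ c S) × (c S ℚ.≤ ℚ.1ℚ)) ×
    (∀ i → x i ≡ sumℚ (map (λ S → c S ℚ.* eℚ S i) K))

-- Lattice L generated by all e_S with |S| = k: finite integer combinations
InLattice : (n k : ℕ) → (Fin n → ℤ) → Set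
InLattice n k x =
  Σ (List (ℤ × Subset n)) λ gs →
    All (λ g → ∣ proj₂ g ∣ ≡ k) gs ×
    (∀ i → x i ≡ sumℤ (map (λ g → proj₁ g ℤ.* eℤ (proj₂ g) i) gs))

degSeq : {n : ℕ} → List (Subset n) → Fin n → ℕ
degSeq K i = sum (map (λ S → eℕ S i) K)

IsSubhypergraph : {n : ℕ} → List (Subset n) → List (Subset n) → Set
IsSubhypergraph K K' = Unique K × All (_∈ K') K

w₀ : Fin 16 → ℤ
w₀ i = lookup (+ 8 ∷ + 6 ∷ + 6 ∷ + 4 ∷ + 1 ∷ + 1 ∷ + 0 ∷ + 0 ∷ + 0 ∷ + 0 ∷
               ℤ.- + 2 ∷ ℤ.- + 2 ∷ ℤ.- + 3 ∷ ℤ.- + 3 ∷ ℤ.- + 5 ∷ ℤ.- + 12 ∷ []) i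

p₀ : Fin 16 → ℕ
p₀ i = lookup (2 ∷ 1 ∷ 1 ∷ 2 ∷ 1 ∷ 1 ∷ 1 ∷ 1 ∷ 1 ∷ 1 ∷ 1 ∷ 1 ∷ 2 ∷ 2 ∷ 2 ∷ 1 ∷ []) i

module Submission where

-- K⁰ has exactly 15 triples (listed below).  Putting weight 2/3
-- on six of them and 1/3 on the other nine gives p, so p ∈ D(K⁰); and p is the
-- degree sequence of seven (arbitrary) triples, hence lies in the lattice L,
-- because every degree sequence of a 3-uniform hypergraph does.
--
-- Negative part: a divisibility obstruction.  Let T = {7,8,9,10} be the vertices
-- of weight 0.  A triple summing to 0 contains either no zero-weight vertex or
-- three of them, so every edge of K⁰ meets T in 0 or 3 vertices.  Exchanging
-- the order of summation, the total degree on T of any K ⊆ K⁰ is therefore a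
-- multiple of 3, whereas p has total 4 on T.

open import Defs
open import Data.Integer using (+_)
open import Data.Rational using (_/_)
open import Data.List using (List)
open import Data.Fin.Subset using (Subset)
open import Data.Product using (_×_; ∃)
open import Relation.Binary.PropositionalEquality using (_≡_)
open import Relation.Nullary using (¬_)

open import Data.Nat using (ℕ; _+_)
open import Data.Nat.Properties using (+-commutativeSemigroup; _≟_)
open import Data.Nat.Divisibility using (_∣_; _∣?_; _∣0; ∣m∣n⇒∣m+n)
open import Data.Nat.ListAction using (sum)
import Data.Integer as ℤ
import Data.Integer.Properties as ℤP
import Data.Rational as ℚ
import Data.Rational.Properties as ℚP
open import Data.Bool using (true; false; if_then_else_)
import Data.Bool.Properties as BoolP
open import Data.Fin using (Fin; #_)
import Data.Fin.Properties as FinP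
open import Data.Fin.Subset using (⁅_⁆; _∪_; ∣_∣)
open import Data.Vec.Properties using (≡-dec)
open import Data.List using ([]; _∷_; map)
open import Data.List.Properties using (map-cong)
open import Data.List.Membership.Propositional using (_∈_)
open import Data.List.Membership.DecPropositional (≡-dec {n = 16} BoolP._≟_) using (_∈?_)
open import Data.List.Relation.Unary.All as All using (All; []; _∷_; all?)
open import Data.List.Relation.Unary.All.Properties using (map⁺)
open import Data.Product using (_,_; proj₁; proj₂)
open import Relation.Binary.PropositionalEquality using (refl; cong; cong₂; subst; sym; trans; module ≡-Reasoning)
open import Relation.Nullary.Decidable using (from-yes; from-no; ⌊_⌋)
open import Algebra.Properties.CommutativeSemigroup +-commutativeSemigroup using (interchange)

sum-map-+ : {A : Set} (f g : A → ℕ) (xs : List A) →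
            sum (map (λ x → f x + g x) xs) ≡ sum (map f xs) + sum (map g xs)
sum-map-+ f g []       = refl
sum-map-+ f g (x ∷ xs) = begin
  (f x + g x) + sum (map (λ x → f x + g x) xs)   ≡⟨ cong (_+_ (f x + g x)) (sum-map-+ f g xs) ⟩
  (f x + g x) + (sum (map f xs) + sum (map g xs)) ≡⟨ interchange (f x) (g x) _ _ ⟩
  (f x + sum (map f xs)) + (g x + sum (map g xs)) ∎
  where open ≡-Reasoning

sum-exchange : {A B : Set} (f : A → B → ℕ) (as : List A) (bs : List B) →
               sum (map (λ b → sum (map (λ a → f a b) as)) bs)
             ≡ sum (map (λ a → sum (map (f a) bs)) as)
sum-exchange f []       bs = sum-zeros bs
  where
  sum-zeros : {B : Set} (bs : List B) → sum (map (λ _ → 0) bs) ≡ 0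
  sum-zeros []       = refl
  sum-zeros (_ ∷ bs) = sum-zeros bs
sum-exchange f (a ∷ as) bs = begin
  sum (map (λ b → f a b + sum (map (λ a → f a b) as)) bs)
    ≡⟨ sum-map-+ (f a) (λ b → sum (map (λ a → f a b) as)) bs ⟩
  sum (map (f a) bs) + sum (map (λ b → sum (map (λ a → f a b) as)) bs)
    ≡⟨ cong (_+_ (sum (map (f a) bs))) (sum-exchange f as bs) ⟩
  sum (map (f a) bs) + sum (map (λ a → sum (map (f a) bs)) as) ∎
  where open ≡-Reasoning

∣-sum : {A : Set} {m : ℕ} (f : A → ℕ) (xs : List A) →
        All (λ x → m ∣ f x) xs → m ∣ sum (map f xs)
∣-sum f []       []         = _ ∣0
∣-sum f (x ∷ xs) (m∣fx ∷ ms) = ∣m∣n⇒∣m+n m∣fx (∣-sum f xs ms)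

degree-sum-by-edges : {n : ℕ} (K : List (Subset n)) (T : List (Fin n)) →
                      sum (map (degSeq K) T) ≡ sum (map (λ S → sum (map (eℕ S) T)) K)
degree-sum-by-edges K T = sum-exchange eℕ K T

degree-obstruction : {n : ℕ} (m : ℕ) (T : List (Fin n)) (K' K : List (Subset n)) →
                     All (λ S → m ∣ sum (map (eℕ S) T)) K' → All (_∈ K') K →
                     m ∣ sum (map (degSeq K) T)
degree-obstruction m T K' K edges-of-K' K⊆K' =
  subst (m ∣_) (sym (degree-sum-by-edges K T))
        (∣-sum (λ S → sum (map (eℕ S) T)) K (All.map (All.lookup edges-of-K') K⊆K'))

-- The degree sequence of a k-uniform (multi)hypergraph lies in the lattice L:
-- it is the combination of its own edges with all coefficients 1.
degSeq-in-lattice : {n k : ℕ} (K : List (Subset n)) → All (λ S → ∣ S ∣ ≡ k) K →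
                    (x : Fin n → ℤ.ℤ) → (∀ i → x i ≡ + degSeq K i) → InLattice n k x
degSeq-in-lattice K uniform x x≡deg =
  map (+ 1 ,_) K , map⁺ uniform , λ i → trans (x≡deg i) (degree-as-combination K i)
  where
  degree-as-combination : ∀ K i →
    + degSeq K i ≡ sumℤ (map (λ g → proj₁ g ℤ.* eℤ (proj₂ g) i) (map (+ 1 ,_) K))
  degree-as-combination []      i = refl
  degree-as-combination (S ∷ K) i = begin
    + (eℕ S i + degSeq K i)         ≡⟨ ℤP.pos-+ (eℕ S i) (degSeq K i) ⟩
    eℤ S i ℤ.+ + degSeq K i         ≡⟨ cong₂ ℤ._+_ (sym (ℤP.*-identityˡ (eℤ S i)))
                                                    (degree-as-combination K i) ⟩
    + 1 ℤ.* eℤ S i ℤ.+ sumℤ (map (λ g → proj₁ g ℤ.* eℤ (proj₂ g) i) (map (+ 1 ,_) K)) ∎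
    where open ≡-Reasoning

-- The data of Proposition 2.2.  Vertices are numbered 0,…,15 (vertex i here is
-- vertex i+1 of the paper).

triple : {n : ℕ} → Fin n → Fin n → Fin n → Subset n
triple a b c = ⁅ a ⁆ ∪ ⁅ b ⁆ ∪ ⁅ c ⁆

K⁰-edges : List (Subset 16)
K⁰-edges =
  triple (# 0) (# 3) (# 15)  ∷ triple (# 0) (# 12) (# 14) ∷ triple (# 0) (# 13) (# 14) ∷
  triple (# 1) (# 2) (# 15)  ∷ triple (# 1) (# 12) (# 13) ∷ triple (# 2) (# 12) (# 13) ∷
  triple (# 3) (# 4) (# 14)  ∷ triple (# 3) (# 5) (# 14)  ∷ triple (# 3) (# 10) (# 11) ∷
  triple (# 4) (# 5) (# 10)  ∷ triple (# 4) (# 5) (# 11)  ∷ triple (# 6) (# 7) (# 8)   ∷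
  triple (# 6) (# 7) (# 9)   ∷ triple (# 6) (# 8) (# 9)   ∷ triple (# 7) (# 8) (# 9)   ∷ []

-- Enumeration of K⁰ (a finite computation over all 2¹⁶ subsets).
K⁰-explicit : K0 16 3 w₀ ≡ K⁰-edges
K⁰-explicit = refl

heavy-edges : List (Subset 16)
heavy-edges =
  triple (# 0) (# 3) (# 15)  ∷ triple (# 0) (# 12) (# 14) ∷ triple (# 0) (# 13) (# 14) ∷
  triple (# 1) (# 12) (# 13) ∷ triple (# 2) (# 12) (# 13) ∷ triple (# 3) (# 10) (# 11) ∷ []

coefficient : Subset 16 → ℚ.ℚ
coefficient S = if ⌊ S ∈? heavy-edges ⌋ then + 2 / 3 else + 1 / 3

coefficient-bounds : ∀ S → (ℚ.0ℚ ℚ.≤ coefficient S) × (coefficient S ℚ.≤ ℚ.1ℚ)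
coefficient-bounds S with ⌊ S ∈? heavy-edges ⌋
... | true  = from-yes (ℚ.0ℚ ℚP.≤? + 2 / 3) , from-yes (+ 2 / 3 ℚP.≤? ℚ.1ℚ)
... | false = from-yes (ℚ.0ℚ ℚP.≤? + 1 / 3) , from-yes (+ 1 / 3 ℚP.≤? ℚ.1ℚ)

p-in-zonotope : InZonotope K⁰-edges (λ i → + p₀ i / 1)
p-in-zonotope =
  coefficient , (λ S _ → coefficient-bounds S) ,
  from-yes (FinP.all? λ i → (+ p₀ i / 1) ℚP.≟ sumℚ (map (λ S → coefficient S ℚ.* eℚ S i) K⁰-edges))

lattice-edges : List (Subset 16)
lattice-edges =
  triple (# 0) (# 3) (# 12) ∷ triple (# 0) (# 3) (# 13) ∷ triple (# 12) (# 13) (# 14) ∷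
  triple (# 1) (# 2) (# 14) ∷ triple (# 4) (# 5) (# 6)  ∷ triple (# 7) (# 8) (# 9)    ∷
  triple (# 10) (# 11) (# 15) ∷ []

p-in-lattice : InLattice 16 3 (λ i → + p₀ i)
p-in-lattice =
  degSeq-in-lattice lattice-edges (from-yes (all? (λ S → ∣ S ∣ ≟ 3) lattice-edges)) _
                    (from-yes (FinP.all? λ i → + p₀ i ℤP.≟ + degSeq lattice-edges i))

zero-weight-vertices : List (Fin 16)
zero-weight-vertices = # 6 ∷ # 7 ∷ # 8 ∷ # 9 ∷ []

K⁰-meets-zero-weight-vertices : All (λ S → 3 ∣ sum (map (eℕ S) zero-weight-vertices)) K⁰-edges
K⁰-meets-zero-weight-vertices = from-yes (all? (λ S → 3 ∣? sum (map (eℕ S) zero-weight-vertices)) K⁰-edges)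

p-not-degree-sequence :
  ¬ (∃ λ (K : List (Subset 16)) → IsSubhypergraph K (K0 16 3 w₀) × (∀ i → degSeq K i ≡ p₀ i))
p-not-degree-sequence (K , (_ , K⊆K⁰) , degK≡p) = from-no (3 ∣? 4) (subst (3 ∣_) total-is-4 3∣total)
  where
  3∣total : 3 ∣ sum (map (degSeq K) zero-weight-vertices)
  3∣total = degree-obstruction 3 zero-weight-vertices K⁰-edges K K⁰-meets-zero-weight-vertices
              (subst (λ K' → All (_∈ K') K) K⁰-explicit K⊆K⁰)
  total-is-4 : sum (map (degSeq K) zero-weight-vertices) ≡ 4
  total-is-4 = cong sum (map-cong degK≡p zero-weight-vertices)

proposition2p2 : (InZonotope (K0 16 3 w₀) (λ i → + p₀ i / 1) × InLattice 16 3 (λ i → + p₀ i))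
    × ¬ (∃ λ (K : List (Subset 16)) → IsSubhypergraph K (K0 16 3 w₀) × (∀ i → degSeq K i ≡ p₀ i))
proposition2p2 =
  (subst (λ K' → InZonotope K' (λ i → + p₀ i / 1)) (sym K⁰-explicit) p-in-zonotope , p-in-lattice) ,
  p-not-degree-sequence
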